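{- $\#\mathrm{ACSP}(\{Implies\}\cup\mathcal{U}^{(-)})\le^L\#\mathrm{Acyc\text{ - }2SAT}$, where $\mathcal{U}^{(-)}=\{[0,1],[1,0],[0,0],[1,1]\}$.
   Context: Unary functions are written $[f(0),f(1)]$; $Implies=(1,1,0,1)$ in the notation $(f(00),f(01),f(10),f(11))$; $\Delta_0=[1,0]$, $\Delta_1=[0,1]$. A hypergraph is acyclic if repeatedly deleting vertices lying in at most one hyperedge and deleting hyperedges empty or contained in another yields the empty hypergraph. $\#\mathrm{ACSP}(\mathcal{F})$: given $I=(Var,C)$, $C$ a finite set of constraints $(f_i,(v_{i_1},\dots,v_{i_{k_i}}))$ with $f_i\in\mathcal{F}\cup\{\Delta_0,\Delta_1\}$ whose hypergraph on $Var$ (hyperedges $\{v_{i_1},\dots,v_{i_{k_i}}\}$) is acyclic, output $\sum_{\sigma:Var\to\{0,1\}}\prod_i f_i(\sigma(v_{i_1}),\dots,\sigma(v_{i_{k_i}}))$. $\#\mathrm{Acyc\text{ - }2SAT}$: given a 2CNF formula whose hypergraph (vertices = variables, hyperedges = variable sets of clauses) is acyclic, output its number of satisfying assignments. $F\le^L F'$: there is a polynomially bounded $h$ computable deterministically in polynomial time and logarithmic space with $F(x)=F'(h(x))$ for all $x$. -}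

module Defs where

open import Data.Bool using (Bool; true; false; if_then_else_)
open import Data.Nat using (ℕ; zero; suc; _+_; _*_; _^_; _≤_; _⊔_; _⊓_; _≡ᵇ_)
open import Data.Nat.Logarithm using (⌊log₂_⌋)
open import Data.Nat.Binary.Base using (ℕᵇ; zero; 2[1+_]; 1+[2_]) renaming (fromℕ to toBin)
open import Data.Fin using (Fin; toℕ; _≟_)
open import Data.Vec using (Vec; []; _∷_; lookup; toList)
open import Data.List using (List; []; _∷_; _++_; [_]; map; concatMap; allFin; filter; length)
open import Data.Nat.ListAction using (sum; product)
open import Data.List.Membership.Propositional using (_∈_)
open import Data.List.Relation.Binary.Subset.Propositional using (_⊆_)
open import Data.Maybe using (Maybe; just; nothing)
open import Data.Product using (Σ; _×_; _,_; ∃)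
open import Data.Sum using (_⊎_)
open import Relation.Nullary using (¬?)
open import Relation.Binary.PropositionalEquality using (_≡_)
open import Relation.Binary.Construct.Closure.ReflexiveTransitive using (Star)

-- Counting problem #ACSP({Implies} ∪ U^(-)) (with Δ₀, Δ₁ always allowed)

data FSym : Set where
  implies u01 u10 u00 u11 delta0 delta1 : FSym

arity : FSym → ℕ
arity implies = 2
arity _       = 1

b2n : Bool → ℕ
b2n true  = 1
b2n false = 0

evalF : (f : FSym) → Vec Bool (arity f) → ℕ
evalF implies (a ∷ b ∷ []) = b2n (if a then b else true)
evalF u01    (a ∷ []) = b2n a
evalF u10    (a ∷ []) = b2n (if a then false else true)
evalF u00    (a ∷ []) = 0
evalF u11    (a ∷ []) = 1
evalF delta0 (a ∷ []) = b2n (if a then false else true)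
evalF delta1 (a ∷ []) = b2n a

Constraint : ℕ → Set
Constraint n = Σ FSym (λ f → Vec (Fin n) (arity f))

ACSPInst : ℕ → Set
ACSPInst n = List (Constraint n)

assignments : (n : ℕ) → List (Vec Bool n)
assignments zero    = [] ∷ []
assignments (suc n) = concatMap (λ a → (false ∷ a) ∷ (true ∷ a) ∷ []) (assignments n)

evalC : ∀ {n} → Vec Bool n → Constraint n → ℕ
evalC σ (f , vs) = evalF f (Data.Vec.map (lookup σ) vs)

countACSP : ∀ {n} → ACSPInst n → ℕ
countACSP {n} I = sum (map (λ σ → product (map (evalC σ) I)) (assignments n))

-- Hypergraph acyclicity (GYO reduction), hypergraph on vertex set Fin n

-- state: remaining vertices, remaining hyperedges (edges as lists, read as sets)
HState : ℕ → Set
HState n = List (Fin n) × List (List (Fin n))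

removeV : ∀ {n} → Fin n → List (Fin n) → List (Fin n)
removeV v = filter (λ u → ¬? (u ≟ v))

data GYOStep {n : ℕ} : HState n → HState n → Set where
  delVertex : ∀ {V E} (v : Fin n) → v ∈ V →
    (∀ e e' → e ∈ E → e' ∈ E → v ∈ e → v ∈ e' → (e ⊆ e' × e' ⊆ e)) →
    GYOStep (V , E) (removeV v V , map (removeV v) E)
  delEdge : ∀ {V} E₁ e E₂ →
    (e ≡ [] ⊎ ∃ (λ e' → e' ∈ (E₁ ++ E₂) × e ⊆ e')) →
    GYOStep (V , E₁ ++ (e ∷ E₂)) (V , E₁ ++ E₂)

AcyclicHyp : (n : ℕ) → List (List (Fin n)) → Set
AcyclicHyp n E = Star GYOStep (allFin n , E) ([] , [])

AcyclicACSP : ∀ {n} → ACSPInst n → Set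
AcyclicACSP {n} I = AcyclicHyp n (map (λ c → toList (Data.Product.proj₂ c)) I)

Literal : ℕ → Set
Literal n = Bool × Fin n     -- (polarity, variable); (true , v) means v, (false , v) means ¬v

data Clause (n : ℕ) : Set where
  one : Literal n → Clause n
  two : Literal n → Literal n → Clause n

TwoCNF : ℕ → Set
TwoCNF n = List (Clause n)

litVal : ∀ {n} → Vec Bool n → Literal n → Bool
litVal σ (p , v) = if p then lookup σ v else (if lookup σ v then false else true)

clauseVal : ∀ {n} → Vec Bool n → Clause n → Bool
clauseVal σ (one l)   = litVal σ l
clauseVal σ (two l k) = if litVal σ l then true else litVal σ k

count2SAT : ∀ {n} → TwoCNF n → ℕ
count2SAT {n} φ = sum (map (λ σ → product (map (λ c → b2n (clauseVal σ c)) φ)) (assignments n))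

clauseVars : ∀ {n} → Clause n → List (Fin n)
clauseVars (one (_ , v))          = v ∷ []
clauseVars (two (_ , v) (_ , w))  = v ∷ w ∷ []

Acyclic2CNF : ∀ {n} → TwoCNF n → Set
Acyclic2CNF {n} φ = AcyclicHyp n (map clauseVars φ)

data Sym : Set where
  s0 s1 sC sV : Sym   -- bits, constraint separator, argument separator

bitsᵇ : ℕᵇ → List Sym    -- bijective base-2 digits, least significant first
bitsᵇ zero     = []
bitsᵇ 2[1+ x ] = s1 ∷ bitsᵇ x
bitsᵇ 1+[2 x ] = s0 ∷ bitsᵇ x

bin : ℕ → List Sym
bin n = bitsᵇ (toBin n)

code : FSym → ℕ
code implies = 0
code u01 = 1
code u10 = 2
code u00 = 3
code u11 = 4
code delta0 = 5
code delta1 = 6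

encConstraint : ∀ {n} → Constraint n → List Sym
encConstraint (f , vs) = sC ∷ bin (code f) ++ concatMap (λ v → sV ∷ bin (toℕ v)) (toList vs)

encACSP : ∀ {n} → ACSPInst n → List Sym
encACSP {n} I = bin n ++ concatMap encConstraint I

encLit : ∀ {n} → Literal n → List Sym
encLit (p , v) = sV ∷ (if p then s1 else s0) ∷ bin (toℕ v)

encClause : ∀ {n} → Clause n → List Sym
encClause (one l)   = sC ∷ encLit l
encClause (two l k) = sC ∷ encLit l ++ encLit k

enc2CNF : ∀ {n} → TwoCNF n → List Sym
enc2CNF {n} φ = bin n ++ concatMap encClause φ

-- Deterministic transducers: read-only input tape with endmarkers,
-- one work tape, write-only one-way output tape.

data Move : Set where
  mL mS mR : Move

data InSym : Set where
  lend rend : InSym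
  ins : Sym → InSym

WSym : Set
WSym = Maybe Sym   -- nothing = blank

record TM : Set where
  field
    Q     : ℕ
    start : Fin Q
    -- nothing = halt; otherwise (new state, symbol written on work tape,
    -- input-head move, work-head move, optional output symbol)
    δ     : Fin Q → InSym → WSym → Maybe (Fin Q × WSym × Move × Move × Maybe Sym)

record Config (M : TM) : Set where
  constructor cfg
  field
    state : Fin (TM.Q M)
    ipos  : ℕ
    tape  : ℕ → WSym
    wpos  : ℕ
    maxw  : ℕ          -- largest work-tape cell visited so far
    out   : List Sym

readIn : List Sym → ℕ → InSym
readIn x zero = lend
readIn x (suc j) = go x j
  where
  go : List Sym → ℕ → InSym
  go [] _ = rend
  go (s ∷ _) zero = ins s
  go (_ ∷ xs) (suc k) = go xs k

moveIn : ℕ → Move → ℕ → ℕ       -- positions 0 .. len+1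
moveIn len mL zero    = zero
moveIn len mL (suc i) = i
moveIn len mS i       = i
moveIn len mR i       = suc i ⊓ suc len

moveW : Move → ℕ → ℕ
moveW mL zero    = zero
moveW mL (suc i) = i
moveW mS i       = i
moveW mR i       = suc i

initCfg : (M : TM) → Config M
initCfg M = cfg (TM.start M) 0 (λ _ → nothing) 0 0 []

step : (M : TM) → List Sym → Config M → Maybe (Config M)
step M x (cfg q i t w m o) with TM.δ M q (readIn x i) (t w)
... | nothing = nothing
... | just (q' , a , di , dw , os) =
  just (cfg q' (moveIn (length x) di i) (λ k → if k ≡ᵇ w then a else t k)
            (moveW dw w) (m ⊔ moveW dw w) (o ++ outp os))
  where
  outp : Maybe Sym → List Sym
  outp nothing  = []
  outp (just s) = [ s ]

-- run for at most `fuel` steps; just c iff the machine halts in configuration c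
run : (M : TM) → List Sym → ℕ → Config M → Maybe (Config M)
run M x fuel c with step M x c
... | nothing = just c
run M x zero    c | just _  = nothing
run M x (suc f) c | just c' = run M x f c'

ComputesLogspacePoly : (M : TM) → ℕ → (List Sym → List Sym) → Set
ComputesLogspacePoly M k h = ∀ x → Σ ℕ λ t → Σ (Config M) λ c →
    t ≤ k * length x ^ k + k
  × run M x t (initCfg M) ≡ just c
  × Config.out c ≡ h x
  × Config.maxw c ≤ k * ⌊log₂ (length x) ⌋ + k
  × length (h x) ≤ k * length x ^ k + k

LogspaceComputable : (List Sym → List Sym) → Set
LogspaceComputable h = Σ TM λ M → Σ ℕ λ k → ComputesLogspacePoly M k h

-- Every constraint is replaced by clauses over its own variables: Implies(v, w) by ¬v ∨ w, [0,1] and Δ₁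
-- by v, [1,0] and Δ₀ by ¬v, the constant [0,0] by the two clauses v and ¬v, and the constant [1,1] by the
-- tautology v ∨ ¬v. Under every assignment the weight of a constraint is the product of the indicators of
-- its clauses, so the counts agree; and each hyperedge is only replaced by copies of itself up to set
-- equality, which a GYO reduction deletes again, so acyclicity is preserved.
--
-- The translation is computed by a transducer that never moves its work head. It reads the input once from
-- left to right, except that for [0,0] and [1,1] it must write the variable twice: it copies it, walks back
-- over its bits to the separator in front of it, and copies it again. It halts within quadratically many
-- steps because a potential drops at every step; its leading digit is the distance from the right end of
-- the input to an anchor that never moves left: the head itself, or the separator of the variable being
-- duplicated.

module Submission where

open import Defs
open import Data.Bool using (Bool; true; false; if_then_else_; T)
open import Data.Nat using (ℕ; zero; suc; pred; _+_; _*_; _∸_; _^_; _≤_; _<_; _<ᵇ_; z≤n; s≤s; s≤s⁻¹)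
open import Data.Nat.Properties
  using ( ≤-refl; ≤-reflexive; ≤-trans; ≤-<-trans; module ≤-Reasoning; n≮0; n≤1+n; n<1+n; m≤n⇒m≤1+n
        ; <ᵇ⇒<; +-comm; +-suc; +-identityʳ; *-suc; *-zeroʳ; *-identityʳ; *-distribʳ-+
        ; m≤m+n; m≤n+m; m<m+n; m≤m*n; m≤n*m; m∸n≤m; m≤n⇒m⊓n≡m; m⊓n≤n
        ; +-monoˡ-≤; +-monoʳ-≤; +-monoʳ-<; *-monoˡ-≤; *-monoʳ-≤; *-mono-≤; ^-monoʳ-≤; ∸-monoʳ-< )
open import Data.Nat.Binary.Base using (zero; 2[1+_]; 1+[2_])
open import Data.Nat.Logarithm using (⌊log₂_⌋)
open import Data.Nat.ListAction using (sum; product)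
open import Data.Nat.ListAction.Properties using (product-++)
open import Data.Nat.Tactic.RingSolver using (solve-∀)
open import Data.Fin using (Fin; #_; toℕ; _≟_)
open import Data.Vec using (Vec; []; _∷_; lookup; toList)
open import Data.List using (List; []; _∷_; _++_; [_]; length; map; concatMap; fromMaybe)
open import Data.List.Properties using (++-assoc; ++-identityʳ; length-++; map-++; map-cong; concatMap-++)
open import Data.List.Membership.Propositional using (_∈_)
open import Data.List.Membership.Propositional.Properties using (∈-++⁺ʳ; ∈-++⁻)
open import Data.List.Relation.Unary.All using (All; []; _∷_)
import Data.List.Relation.Unary.All as All
open import Data.List.Relation.Unary.All.Properties using (map⁺)
open import Data.List.Relation.Unary.Any using (here; there)
open import Data.List.Relation.Binary.Subset.Propositional using (_⊆_)
open import Data.List.Relation.Binary.Subset.Propositional.Properties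
  using (⊆-refl; ⊆-trans; ⊆[]⇒≡[]; filter⁺′; ++⁺ʳ; xs⊆ys++xs; xs⊆x∷xs; ∈-∷⁺ʳ)
open import Data.Maybe using (Maybe; just; nothing)
import Data.Maybe as Maybe
open import Data.Product using (Σ; ∃; ∃₂; _×_; _,_; proj₁; proj₂)
open import Data.Sum using (_⊎_; inj₁; inj₂)
open import Data.Unit using (tt)
open import Data.Empty using (⊥-elim)
open import Function using (_∘_)
open import Relation.Nullary using (¬_; ¬?)
open import Relation.Unary using (U)
open import Relation.Binary.PropositionalEquality
  using (_≡_; refl; sym; trans; cong; cong₂; subst; subst₂; module ≡-Reasoning)
open import Relation.Binary.Construct.Closure.ReflexiveTransitive using (Star; ε; _◅_; _◅◅_)

-- Constraints as clauses

clauses : ∀ {n} → Constraint n → List (Clause n)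
clauses (implies , v ∷ w ∷ []) = two (false , v) (true , w) ∷ []
clauses (u01    , v ∷ [])     = one (true , v) ∷ []
clauses (u10    , v ∷ [])     = one (false , v) ∷ []
clauses (u00    , v ∷ [])     = one (true , v) ∷ one (false , v) ∷ []
clauses (u11    , v ∷ [])     = two (true , v) (false , v) ∷ []
clauses (delta0 , v ∷ [])     = one (false , v) ∷ []
clauses (delta1 , v ∷ [])     = one (true , v) ∷ []

translate : ∀ {n} → ACSPInst n → TwoCNF n
translate = concatMap clauses

clauseWeight : ∀ {n} → Vec Bool n → Clause n → ℕ
clauseWeight σ d = b2n (clauseVal σ d)

evalC-clauses : ∀ {n} (σ : Vec Bool n) c → evalC σ c ≡ product (map (clauseWeight σ) (clauses c))
evalC-clauses σ (implies , v ∷ w ∷ []) with lookup σ v | lookup σ w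
... | false | _     = refl
... | true  | false = refl
... | true  | true  = refl
evalC-clauses σ (u01    , v ∷ []) with lookup σ v
... | false = refl
... | true  = refl
evalC-clauses σ (u10    , v ∷ []) with lookup σ v
... | false = refl
... | true  = refl
evalC-clauses σ (u00    , v ∷ []) with lookup σ v
... | false = refl
... | true  = refl
evalC-clauses σ (u11    , v ∷ []) with lookup σ v
... | false = refl
... | true  = refl
evalC-clauses σ (delta0 , v ∷ []) with lookup σ v
... | false = refl
... | true  = refl
evalC-clauses σ (delta1 , v ∷ []) with lookup σ v
... | false = refl
... | true  = refl

product-map-concatMap : ∀ {A B : Set} (g : B → ℕ) (f : A → List B) xs →
  product (map g (concatMap f xs)) ≡ product (map (product ∘ map g ∘ f) xs)
product-map-concatMap g f []       = refl
product-map-concatMap g f (x ∷ xs) = begin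
  product (map g (f x ++ concatMap f xs))                  ≡⟨ cong product (map-++ g (f x) _) ⟩
  product (map g (f x) ++ map g (concatMap f xs))          ≡⟨ product-++ (map g (f x)) _ ⟩
  product (map g (f x)) * product (map g (concatMap f xs))
    ≡⟨ cong (product (map g (f x)) *_) (product-map-concatMap g f xs) ⟩
  product (map g (f x)) * product (map (product ∘ map g ∘ f) xs) ∎
  where open ≡-Reasoning

translate-count : ∀ {n} (I : ACSPInst n) → countACSP I ≡ count2SAT (translate I)
translate-count {n} I = cong sum (map-cong weight-preserved (assignments n))
  where
  weight-preserved : ∀ σ → product (map (evalC σ) I) ≡ product (map (clauseWeight σ) (translate I))
  weight-preserved σ = trans (cong product (map-cong (evalC-clauses σ) I))
                             (sym (product-map-concatMap (clauseWeight σ) clauses I))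

-- Acyclicity survives duplicating hyperedges

module _ {n : ℕ} where

  private
    Edge = List (Fin n)

  infix 4 _≋_
  _≋_ : Edge → Edge → Set
  a ≋ b = a ⊆ b × b ⊆ a

  ≋-refl : ∀ {a} → a ≋ a
  ≋-refl = ⊆-refl , ⊆-refl

  Copies : Edge → List Edge → Set
  Copies e B = All (e ≋_) B × ¬ B ≡ []

  data Duplicates : List Edge → List Edge → Set where
    []  : Duplicates [] []
    _∷_ : ∀ {e B Es Es′} → Copies e B → Duplicates Es Es′ → Duplicates (e ∷ Es) (B ++ Es′)

  duplicates-forth : ∀ {Es Es′ e} → Duplicates Es Es′ → e ∈ Es → ∃ λ e′ → e′ ∈ Es′ × e ≋ e′
  duplicates-forth (([] , nonempty) ∷ _) (here refl) = ⊥-elim (nonempty refl)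
  duplicates-forth ((e≋b ∷ _ , _) ∷ _)  (here refl) = _ , here refl , e≋b
  duplicates-forth (_∷_ {B = B} _ dups) (there e∈) with duplicates-forth dups e∈
  ... | e′ , e′∈ , e≋e′ = e′ , ∈-++⁺ʳ B e′∈ , e≋e′

  duplicates-back : ∀ {Es Es′ e′} → Duplicates Es Es′ → e′ ∈ Es′ → ∃ λ e → e ∈ Es × e ≋ e′
  duplicates-back (_∷_ {B = B} (copies , _) dups) e′∈ with ∈-++⁻ B e′∈
  ... | inj₁ e′∈B = _ , here refl , All.lookup copies e′∈B
  ... | inj₂ e′∈Es′ with duplicates-back dups e′∈Es′
  ...   | e , e∈ , e≋e′ = e , there e∈ , e≋e′

  duplicates-++ : ∀ {A A′ C C′} → Duplicates A A′ → Duplicates C C′ → Duplicates (A ++ C) (A′ ++ C′)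
  duplicates-++ [] dups′ = dups′
  duplicates-++ {C′ = C′} (_∷_ {B = B} {Es′ = Es′} copies dups) dups′ =
    subst (Duplicates _) (sym (++-assoc B Es′ C′)) (copies ∷ duplicates-++ dups dups′)

  duplicates-split : ∀ E₁ {e E₂ X} → Duplicates (E₁ ++ e ∷ E₂) X →
    ∃₂ λ E₁′ B → ∃ λ E₂′ →
      X ≡ E₁′ ++ B ++ E₂′ × Duplicates E₁ E₁′ × Copies e B × Duplicates E₂ E₂′
  duplicates-split []       (copies ∷ dups) = [] , _ , _ , refl , [] , copies , dups
  duplicates-split (_ ∷ E₁) (_∷_ {B = B} copies dups) with duplicates-split E₁ dups
  ... | E₁′ , B′ , E₂′ , refl , dups₁ , copies′ , dups₂ =
    B ++ E₁′ , B′ , E₂′ , sym (++-assoc B E₁′ _) , copies ∷ dups₁ , copies′ , dups₂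

  removeV-≋ : ∀ v {a b : Edge} → a ≋ b → removeV v a ≋ removeV v b
  removeV-≋ v (a⊆b , b⊆a) = removeV-⊆ a⊆b , removeV-⊆ b⊆a
    where removeV-⊆ = filter⁺′ (λ u → ¬? (u ≟ v)) (λ u → ¬? (u ≟ v)) (λ u≢v → u≢v)

  duplicates-removeV : ∀ v {Es Es′} → Duplicates Es Es′ →
    Duplicates (map (removeV v) Es) (map (removeV v) Es′)
  duplicates-removeV v [] = []
  duplicates-removeV v (_∷_ {B = B} {Es′ = Es′} (copies , nonempty) dups) =
    subst (Duplicates _) (sym (map-++ (removeV v) B Es′))
      ((map⁺ (All.map (removeV-≋ v) copies) , nonempty ∘ map-[] B) ∷ duplicates-removeV v dups)
    where
    map-[] : ∀ (B : List Edge) → map (removeV v) B ≡ [] → B ≡ []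
    map-[] [] _ = refl

  Redundant : List Edge → Edge → Set
  Redundant Es e = e ≡ [] ⊎ ∃ λ e′ → e′ ∈ Es × e ⊆ e′

  redundant-⊆ : ∀ {Es a b} → a ⊆ b → Redundant Es b → Redundant Es a
  redundant-⊆ a⊆b (inj₁ refl)               = inj₁ (⊆[]⇒≡[] a⊆b)
  redundant-⊆ a⊆b (inj₂ (e′ , e′∈ , b⊆e′)) = inj₂ (e′ , e′∈ , ⊆-trans a⊆b b⊆e′)

  redundant-weaken : ∀ {Es Fs e} → Es ⊆ Fs → Redundant Es e → Redundant Fs e
  redundant-weaken Es⊆Fs (inj₁ e≡[])             = inj₁ e≡[]
  redundant-weaken Es⊆Fs (inj₂ (e′ , e′∈ , e⊆e′)) = inj₂ (e′ , Es⊆Fs e′∈ , e⊆e′)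

  redundant-duplicates : ∀ {Es Es′ e} → Duplicates Es Es′ → Redundant Es e → Redundant Es′ e
  redundant-duplicates dups (inj₁ e≡[]) = inj₁ e≡[]
  redundant-duplicates dups (inj₂ (e′ , e′∈ , e⊆e′)) with duplicates-forth dups e′∈
  ... | e″ , e″∈ , (e′⊆e″ , _) = inj₂ (e″ , e″∈ , ⊆-trans e⊆e′ e′⊆e″)

  delete-copies : ∀ {V e} E₁ B E₂ → All (e ≋_) B → Redundant (E₁ ++ E₂) e →
    Star GYOStep (V , E₁ ++ B ++ E₂) (V , E₁ ++ E₂)
  delete-copies E₁ []      E₂ []                 red = ε
  delete-copies E₁ (b ∷ B) E₂ ((_ , b⊆e) ∷ copies) red =
    delEdge E₁ b (B ++ E₂) (redundant-⊆ b⊆e (redundant-weaken (++⁺ʳ E₁ (xs⊆ys++xs E₂ B)) red))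
    ◅ delete-copies E₁ B E₂ copies red

  acyclic-duplicates : ∀ {V Es Es′} → Star GYOStep (V , Es) ([] , []) → Duplicates Es Es′ →
    Star GYOStep (V , Es′) ([] , [])
  acyclic-duplicates ε [] = ε
  acyclic-duplicates {Es′ = Es′} (delVertex v v∈V unique ◅ steps) dups =
    delVertex v v∈V unique′ ◅ acyclic-duplicates steps (duplicates-removeV v dups)
    where
    unique′ : ∀ a b → a ∈ Es′ → b ∈ Es′ → v ∈ a → v ∈ b → a ⊆ b × b ⊆ a
    unique′ a b a∈ b∈ v∈a v∈b with duplicates-back dups a∈ | duplicates-back dups b∈
    ... | a₀ , a₀∈ , (a₀⊆a , a⊆a₀) | b₀ , b₀∈ , (b₀⊆b , b⊆b₀)
      with unique a₀ b₀ a₀∈ b₀∈ (a⊆a₀ v∈a) (b⊆b₀ v∈b)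
    ... | a₀⊆b₀ , b₀⊆a₀ =
      ⊆-trans a⊆a₀ (⊆-trans a₀⊆b₀ b₀⊆b) , ⊆-trans b⊆b₀ (⊆-trans b₀⊆a₀ a₀⊆a)
  acyclic-duplicates (delEdge E₁ e E₂ red ◅ steps) dups with duplicates-split E₁ dups
  ... | E₁′ , B , E₂′ , refl , dups₁ , (copies , _) , dups₂ =
    delete-copies E₁′ B E₂′ copies (redundant-duplicates (duplicates-++ dups₁ dups₂) red)
    ◅◅ acyclic-duplicates steps (duplicates-++ dups₁ dups₂)

  clauses-copies : (c : Constraint n) → Copies (toList (proj₂ c)) (map clauseVars (clauses c))
  clauses-copies (implies , v ∷ w ∷ []) = ≋-refl ∷ [] , λ ()
  clauses-copies (u01    , v ∷ [])     = ≋-refl ∷ [] , λ ()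
  clauses-copies (u10    , v ∷ [])     = ≋-refl ∷ [] , λ ()
  clauses-copies (u00    , v ∷ [])     = ≋-refl ∷ ≋-refl ∷ [] , λ ()
  clauses-copies (u11    , v ∷ [])     = (xs⊆x∷xs (v ∷ []) v , ∈-∷⁺ʳ (here refl) ⊆-refl) ∷ [] , λ ()
  clauses-copies (delta0 , v ∷ [])     = ≋-refl ∷ [] , λ ()
  clauses-copies (delta1 , v ∷ [])     = ≋-refl ∷ [] , λ ()

  translate-duplicates : (I : ACSPInst n) →
    Duplicates (map (λ c → toList (proj₂ c)) I) (map clauseVars (translate I))
  translate-duplicates []      = []
  translate-duplicates (c ∷ I) =
    subst (Duplicates _) (sym (map-++ clauseVars (clauses c) (translate I)))
      (clauses-copies c ∷ translate-duplicates I)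

translate-acyclic : ∀ {n} (I : ACSPInst n) → AcyclicACSP I → Acyclic2CNF (translate I)
translate-acyclic I acyclic = acyclic-duplicates acyclic (translate-duplicates I)

module Iteration {C : Set} (next : C → Maybe C) where

  iterate : ℕ → C → Maybe C
  iterate f a with next a
  ... | nothing = just a
  iterate zero    a | just _ = nothing
  iterate (suc f) a | just b = iterate f b

  _↝_ : C → C → Set
  a ↝ b = next a ≡ just b

  _↝*_ : C → C → Set
  _↝*_ = Star _↝_

  Halted : C → Set
  Halted a = next a ≡ nothing

  iterate-reaches : ∀ f {a d} → iterate f a ≡ just d → a ↝* d × Halted d
  iterate-reaches f {a} eq with next a in step
  iterate-reaches f       refl | nothing = ε , step
  iterate-reaches (suc f) eq   | just b  with iterate-reaches f eq
  ... | path , halted = step ◅ path , halted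

  halted-unique : ∀ {a d e} → a ↝* d → a ↝* e → Halted d → Halted e → d ≡ e
  halted-unique ε       ε       _ _  = refl
  halted-unique ε       (s ◅ _) h _  with () ← trans (sym h) s
  halted-unique (s ◅ _) ε       _ h  with () ← trans (sym h) s
  halted-unique (s ◅ p) (t ◅ q) h h′ with refl ← trans (sym s) t = halted-unique p q h h′

  iterate-within : (Inv : C → Set) (N : C → ℕ) → (∀ {a b} → Inv a → a ↝ b → Inv b × N b < N a) →
    ∀ f {a} → Inv a → N a ≤ f → ∃ λ d → iterate f a ≡ just d
  iterate-within Inv N descent f {a} inv bound with next a in step
  ... | nothing = a , refl
  iterate-within Inv N descent zero    inv bound | just b =
    ⊥-elim (n≮0 (≤-trans (proj₂ (descent inv step)) bound))
  iterate-within Inv N descent (suc f) inv bound | just b =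
    iterate-within Inv N descent f (proj₁ (descent inv step))
      (s≤s⁻¹ (≤-trans (proj₂ (descent inv step)) bound))

  iterate-growth : (size : C → ℕ) → (∀ {a b} → a ↝ b → size b ≤ suc (size a)) →
    ∀ f {a d} → iterate f a ≡ just d → size d ≤ size a + f
  iterate-growth size grows f {a} eq with next a in step
  iterate-growth size grows f       {a} refl | nothing = m≤m+n (size a) f
  iterate-growth size grows (suc f) {a} eq   | just b =
    ≤-trans (iterate-growth size grows f eq)
      (≤-trans (+-monoˡ-≤ f (grows step)) (≤-reflexive (sym (+-suc (size a) f))))

open Iteration using (iterate)

module _ (M : TM) (x : List Sym) {C : Set} (next : C → Maybe C) (R : Config M → C → Set)
  (halts-with : ∀ {c a} → R c a → next a ≡ nothing → step M x c ≡ nothing)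
  (steps-with : ∀ {c a b} → R c a → next a ≡ just b → ∃ λ c′ → step M x c ≡ just c′ × R c′ b)
  where

  run-simulates : ∀ f {c a d} → R c a → iterate next f a ≡ just d →
    ∃ λ c′ → run M x f c ≡ just c′ × R c′ d
  run-simulates f {c} {a} r eq with next a in abstract-step
  run-simulates f       {c} r refl | nothing rewrite halts-with r abstract-step = c , refl , r
  run-simulates (suc f) {c} r eq   | just b with steps-with r abstract-step
  ... | c′ , machine-step , r′ rewrite machine-step = run-simulates f r′ eq

-- Transducers without work tape

data IsBit : Sym → Set where
  instance
    bit0 : IsBit s0
    bit1 : IsBit s1

module WorkTapeFree {St : Set} {Q : ℕ} (state : Fin Q → St) (index : (q : St) → Σ (Fin Q) λ k → state k ≡ q)
  (start : St) (δ : St → InSym → Maybe (St × Move × Maybe Sym)) where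

  record Conf : Set where
    constructor ⟨_,_,_⟩
    field
      current : St
      pos     : ℕ
      out     : List Sym

  open Conf

  next : List Sym → Conf → Maybe Conf
  next x ⟨ q , i , o ⟩ =
    Maybe.map (λ (q′ , m , e) → ⟨ q′ , moveIn (length x) m i , o ++ fromMaybe e ⟩) (δ q (readIn x i))

  machine : TM
  machine = record
    { Q     = Q
    ; start = proj₁ (index start)
    ; δ     = λ k s _ →
        Maybe.map (λ (q′ , m , e) → proj₁ (index q′) , nothing , m , mS , e) (δ (state k) s)
    }

  record Mirrors (c : Config machine) (a : Conf) : Set where
    constructor mirrors
    field
      state≡ : state (Config.state c) ≡ current a
      ipos≡  : Config.ipos c ≡ pos a
      out≡   : Config.out c ≡ out a
      wpos≡  : Config.wpos c ≡ 0
      maxw≡  : Config.maxw c ≡ 0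

  module _ (x : List Sym) where

    halts-mirrored : ∀ {c a} → Mirrors c a → next x a ≡ nothing → step machine x c ≡ nothing
    halts-mirrored {cfg k i _ _ _ _} (mirrors refl refl refl refl refl) halt with δ (state k) (readIn x i)
    ... | nothing = refl

    steps-mirrored : ∀ {c a b} → Mirrors c a → next x a ≡ just b →
      ∃ λ c′ → step machine x c ≡ just c′ × Mirrors c′ b
    steps-mirrored {cfg k i _ _ _ _} (mirrors refl refl refl refl refl) move
      with δ (state k) (readIn x i) | move
    ... | just (q′ , _ , nothing) | refl = _ , refl , mirrors (proj₂ (index q′)) refl refl refl refl
    ... | just (q′ , _ , just _)  | refl = _ , refl , mirrors (proj₂ (index q′)) refl refl refl refl

    next-pos≤ : ∀ {a b} → pos a ≤ suc (length x) → next x a ≡ just b → pos b ≤ suc (length x)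
    next-pos≤ {⟨ q , i , _ ⟩} i≤ move with δ q (readIn x i) | move
    ... | just (_ , mL , _) | refl = moveIn-mL i i≤
      where
      moveIn-mL : ∀ i → i ≤ suc (length x) → moveIn (length x) mL i ≤ suc (length x)
      moveIn-mL zero    _  = z≤n
      moveIn-mL (suc i) i≤ = ≤-trans (n≤1+n i) i≤
    ... | just (_ , mS , _) | refl = i≤
    ... | just (_ , mR , _) | refl = m⊓n≤n (suc i) (suc (length x))

    next-out : ∀ {a b} → next x a ≡ just b → length (out b) ≤ suc (length (out a))
    next-out {⟨ q , i , o ⟩} move with δ q (readIn x i) | move
    ... | just (_ , _ , nothing) | refl = ≤-trans (≤-reflexive (trans (length-++ o) (+-identityʳ _))) (n≤1+n _)
    ... | just (_ , _ , just _)  | refl = ≤-reflexive (trans (length-++ o) (+-comm (length o) 1))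

  Reaches : List Sym → Conf → Conf → Set
  Reaches x = Iteration._↝*_ (next x)

  -- Head position suc j scans symbol j of x (counting from 0; position 0 is the left endmarker), so a
  -- segment w after pre is entered at suc (length pre) and left at suc (length (pre ++ w)).
  Reads : (List Sym → Set) → St → List Sym → St → List Sym → Set
  Reads P q w q′ u = ∀ x pre rest o → P rest → x ≡ pre ++ w ++ rest →
    Reaches x ⟨ q , suc (length pre) , o ⟩ ⟨ q′ , suc (length (pre ++ w)) , o ++ u ⟩

  readIn-after : ∀ pre r → readIn (pre ++ r) (suc (length pre)) ≡ readIn r 1
  readIn-after []        r = refl
  readIn-after (_ ∷ pre) r = readIn-after pre r

  next-at : ∀ {q q′ m e x pre r o} → δ q (readIn r 1) ≡ just (q′ , m , e) → x ≡ pre ++ r →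
    next x ⟨ q , suc (length pre) , o ⟩
      ≡ just ⟨ q′ , moveIn (length x) m (suc (length pre)) , o ++ fromMaybe e ⟩
  next-at {pre = pre} {r} d refl rewrite readIn-after pre r | d = refl

  moveIn-right-after : ∀ pre s (rest : List Sym) →
    moveIn (length (pre ++ s ∷ rest)) mR (suc (length pre)) ≡ suc (length (pre ++ [ s ]))
  moveIn-right-after []        s rest = refl
  moveIn-right-after (_ ∷ pre) s rest = cong suc (moveIn-right-after pre s rest)

  length-snoc : ∀ (pre : List Sym) s → length (pre ++ [ s ]) ≡ suc (length pre)
  length-snoc pre s = trans (length-++ pre) (+-comm (length pre) 1)

  reads-[] : ∀ {P q} → Reads P q [] q []
  reads-[] {q = q} x pre _ o _ _ =
    subst (Reaches x _)
      (cong₂ (λ i o → ⟨ q , suc (length i) , o ⟩) (sym (++-identityʳ pre)) (sym (++-identityʳ o))) ε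

  reads-then : ∀ {P₁ P₂ q₁ q₂ q₃ w₁ w₂ u₁ u₂} → Reads P₁ q₁ w₁ q₂ u₁ → (∀ {r} → P₂ r → P₁ (w₂ ++ r)) →
    Reads P₂ q₂ w₂ q₃ u₂ → Reads P₂ q₁ (w₁ ++ w₂) q₃ (u₁ ++ u₂)
  reads-then {q₃ = q₃} {w₁} {w₂} {u₁} {u₂} A cond B x pre rest o p refl =
    subst (Reaches x _) (cong₂ (λ i o → ⟨ q₃ , suc (length i) , o ⟩) (++-assoc pre w₁ w₂) (++-assoc o u₁ u₂))
      (A x pre (w₂ ++ rest) o (cond p) split ◅◅ B x (pre ++ w₁) rest (o ++ u₁) p split′)
    where
    split  = cong (pre ++_) (++-assoc w₁ w₂ rest)
    split′ = trans split (sym (++-assoc pre w₁ (w₂ ++ rest)))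

  infixr 4 _⨾_
  _⨾_ : ∀ {P q₁ q₂ q₃ w₁ w₂ u₁ u₂} → Reads U q₁ w₁ q₂ u₁ → Reads P q₂ w₂ q₃ u₂ →
    Reads P q₁ (w₁ ++ w₂) q₃ (u₁ ++ u₂)
  A ⨾ B = reads-then A (λ _ → tt) B

  reads-cast : ∀ {P q q′ w w′ u u′} → w ≡ w′ → u ≡ u′ → Reads P q w q′ u → Reads P q w′ q′ u′
  reads-cast {P} {q} {q′} = subst₂ (λ w u → Reads P q w q′ u)

  reads-weaken : ∀ {P q q′ w u} → Reads U q w q′ u → Reads P q w q′ u
  reads-weaken A x pre rest o _ = A x pre rest o tt

  reads-right : ∀ {q q′ s e} → δ q (ins s) ≡ just (q′ , mR , e) → Reads U q [ s ] q′ (fromMaybe e)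
  reads-right {q′ = q′} {s} {e} d x pre rest o _ refl =
    trans (next-at {pre = pre} {r = s ∷ rest} d refl)
          (cong (λ i → just ⟨ q′ , i , o ++ fromMaybe e ⟩) (moveIn-right-after pre s rest))
    ◅ ε

  reads-stay : ∀ {P q q′ q″ s w e u} → δ q (ins s) ≡ just (q′ , mS , e) → Reads P q′ (s ∷ w) q″ u →
    Reads P q (s ∷ w) q″ (fromMaybe e ++ u)
  reads-stay {q″ = q″} {s} {w} {e} {u} d A x pre rest o p refl =
    next-at {pre = pre} {r = s ∷ w ++ rest} d refl
    ◅ subst (Reaches x _) (cong (λ o → ⟨ q″ , _ , o ⟩) (++-assoc o (fromMaybe e) u))
        (A x pre rest (o ++ fromMaybe e) p refl)

  Copying Rewinding : St → Set
  Copying q   = ∀ {b} → IsBit b → δ q (ins b) ≡ just (q , mR , just b)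
  Rewinding q = ∀ {b} → IsBit b → δ q (ins b) ≡ just (q , mL , nothing)

  copier : ∀ {q} → δ q (ins s0) ≡ just (q , mR , just s0) → δ q (ins s1) ≡ just (q , mR , just s1) →
    Copying q
  copier copy0 copy1 bit0 = copy0
  copier copy0 copy1 bit1 = copy1

  rewinder : ∀ {q} → δ q (ins s0) ≡ just (q , mL , nothing) → δ q (ins s1) ≡ just (q , mL , nothing) →
    Rewinding q
  rewinder back0 back1 bit0 = back0
  rewinder back0 back1 bit1 = back1

  reads-bits : ∀ {q bs} → Copying q → All IsBit bs → Reads U q bs q bs
  reads-bits copies []           = reads-[]
  reads-bits copies (bit ∷ bits) = reads-right (copies bit) ⨾ reads-bits copies bits

  rewind : ∀ {q x pre bs rest o} → Rewinding q → All IsBit bs → x ≡ pre ++ bs ++ rest →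
    Reaches x ⟨ q , length (pre ++ bs) , o ⟩ ⟨ q , length pre , o ⟩
  rewind {x = x} {pre} {o = o} rewinds [] refl =
    subst (λ i → Reaches x ⟨ _ , i , o ⟩ ⟨ _ , length pre , o ⟩) (sym (cong length (++-identityʳ pre))) ε
  rewind {q} {x} {pre} {b ∷ bs} {rest} {o} rewinds (bit ∷ bits) refl =
    subst (λ i → Reaches x ⟨ q , i , o ⟩ ⟨ q , length (pre ++ [ b ]) , o ⟩) (cong length (++-assoc pre [ b ] bs))
      (rewind {pre = pre ++ [ b ]} {rest = rest} rewinds bits (sym (++-assoc pre [ b ] (bs ++ rest))))
    ◅◅ subst (λ i → Reaches x ⟨ q , i , o ⟩ ⟨ q , length pre , o ⟩) (sym (length-snoc pre b))
         (trans (next-at {pre = pre} {r = b ∷ bs ++ rest} (rewinds bit) refl)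
                (cong (λ o → just ⟨ q , length pre , o ⟩) (++-identityʳ o))
          ◅ ε)

  AtBoundary : List Sym → Set
  AtBoundary r = r ≡ [] ⊎ ∃ λ r′ → r ≡ sC ∷ r′

  revisit : ∀ {e c k q p bs u} → δ e (ins sV) ≡ just (c , mR , just p) → Copying c →
    δ c (ins sC) ≡ just (k , mL , nothing) → δ c rend ≡ just (k , mL , nothing) → Rewinding k →
    All IsBit bs → Reads U k (sV ∷ bs) q u → Reads AtBoundary e (sV ∷ bs) q (p ∷ bs ++ u)
  revisit {e} {c} {k} {q} {p} {bs} {u} enter copies turn-sC turn-end rewinds bits again
    x pre rest o boundary refl =
    subst (Reaches x _) (cong (λ o → ⟨ q , _ , o ⟩) (++-assoc o (p ∷ bs) u))
      (forward ◅◅ turn ◅ back ◅◅ again x pre rest o′ tt refl)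
    where
    o′ = o ++ p ∷ bs
    forward : Reaches x ⟨ e , suc (length pre) , o ⟩ ⟨ c , suc (length (pre ++ sV ∷ bs)) , o′ ⟩
    forward = (reads-right enter ⨾ reads-bits copies bits) x pre rest o tt refl
    turn-at : AtBoundary rest → δ c (readIn rest 1) ≡ just (k , mL , nothing)
    turn-at (inj₁ refl)       = turn-end
    turn-at (inj₂ (_ , refl)) = turn-sC
    turn : next x ⟨ c , suc (length (pre ++ sV ∷ bs)) , o′ ⟩ ≡ just ⟨ k , length ((pre ++ [ sV ]) ++ bs) , o′ ⟩
    turn = trans (next-at {pre = pre ++ sV ∷ bs} {r = rest} (turn-at boundary)
                          (sym (++-assoc pre (sV ∷ bs) rest)))
             (cong₂ (λ i o → just ⟨ k , i , o ⟩) (sym (cong length (++-assoc pre [ sV ] bs))) (++-identityʳ o′))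
    back : Reaches x ⟨ k , length ((pre ++ [ sV ]) ++ bs) , o′ ⟩ ⟨ k , suc (length pre) , o′ ⟩
    back = subst (λ i → Reaches x ⟨ k , length ((pre ++ [ sV ]) ++ bs) , o′ ⟩ ⟨ k , i , o′ ⟩)
             (length-snoc pre sV)
             (rewind {pre = pre ++ [ sV ]} {rest = rest} rewinds bits (sym (++-assoc pre [ sV ] (bs ++ rest))))

  module Ranked (potential : List Sym → Conf → ℕ)
    (descent : ∀ x {a b} → pos a ≤ suc (length x) → next x a ≡ just b → potential x b < potential x a) where

    initial : Conf
    initial = ⟨ start , 0 , [] ⟩

    halting-run : ∀ x → ∃ λ d → iterate (next x) (potential x initial) initial ≡ just d
    halting-run x = Iteration.iterate-within (next x) (λ a → pos a ≤ suc (length x)) (potential x)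
      (λ inv move → next-pos≤ x inv move , descent x inv move) (potential x initial) z≤n ≤-refl

    transduce : List Sym → List Sym
    transduce x = out (proj₁ (halting-run x))

    transduce-reaches : ∀ {x e} → Reaches x initial e → next x e ≡ nothing → transduce x ≡ out e
    transduce-reaches {x} path halted =
      let reached , stopped = Iteration.iterate-reaches (next x) _ (proj₂ (halting-run x))
      in cong out (Iteration.halted-unique (next x) reached path stopped halted)

    transduce-logspace : ∀ k → (∀ x → potential x initial ≤ k * length x ^ k + k) → LogspaceComputable transduce
    transduce-logspace k bound = machine , k , λ x →
      let t = potential x initial
          d , runs = halting-run x
          c , machine-runs , mirrors _ _ out≡ _ maxw≡ =
            run-simulates machine x (next x) Mirrors (halts-mirrored x) (steps-mirrored x) t
              (mirrors (proj₂ (index start)) refl refl refl refl) runs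
      in t , c , bound x , machine-runs , out≡
         , subst (_≤ k * ⌊log₂ length x ⌋ + k) (sym maxw≡) z≤n
         , ≤-trans (Iteration.iterate-growth (next x) (λ a → length (out a)) (next-out x) t runs) (bound x)

-- readCodeab has read the code digits a, b of a constraint (bijective base 2, least significant digit
-- first, see bin); e.g. readCode10 has recognised code 4, the constraint [1,1].
data St : Set where
  copyVar readCode readCode0 readCode1 readCode00 readCode01 readCode10 readCode11 copyFirst : St
  emitPos emitNeg emitImplies emitTaut emitContra : St
  copyTaut copyContra backTaut backContra openClause secondNeg : St

states : Vec St 20
states = copyVar ∷ readCode ∷ readCode0 ∷ readCode1 ∷ readCode00 ∷ readCode01 ∷ readCode10 ∷ readCode11 ∷
         copyFirst ∷ emitPos ∷ emitNeg ∷ emitImplies ∷ emitTaut ∷ emitContra ∷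
         copyTaut ∷ copyContra ∷ backTaut ∷ backContra ∷ openClause ∷ secondNeg ∷ []

index : (q : St) → Σ (Fin 20) λ k → lookup states k ≡ q
index copyVar     = # 0  , refl
index readCode    = # 1  , refl
index readCode0   = # 2  , refl
index readCode1   = # 3  , refl
index readCode00  = # 4  , refl
index readCode01  = # 5  , refl
index readCode10  = # 6  , refl
index readCode11  = # 7  , refl
index copyFirst   = # 8  , refl
index emitPos     = # 9  , refl
index emitNeg     = # 10 , refl
index emitImplies = # 11 , refl
index emitTaut    = # 12 , refl
index emitContra  = # 13 , refl
index copyTaut    = # 14 , refl
index copyContra  = # 15 , refl
index backTaut    = # 16 , refl
index backContra  = # 17 , refl
index openClause  = # 18 , refl
index secondNeg   = # 19 , refl

data Phase : Set where
  scan copy back : Phase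

phase : St → Phase
phase copyTaut   = copy
phase copyContra = copy
phase backTaut   = back
phase backContra = back
phase openClause = back
phase secondNeg  = back
phase _          = scan

rank : St → ℕ
rank emitPos     = 0
rank emitNeg     = 0
rank emitImplies = 0
rank emitTaut    = 0
rank emitContra  = 0
rank backTaut    = 3
rank backContra  = 3
rank openClause  = 2
rank _           = 1

data NotRend : InSym → Set where
  instance
    lend-NotRend : NotRend lend
    ins-NotRend  : ∀ {s} → NotRend (ins s)

data NotLend : InSym → Set where
  instance
    rend-NotLend : NotLend rend
    ins-NotLend  : ∀ {s} → NotLend (ins s)

data Settles : Phase → Set where
  instance
    scan-Settles : Settles scan
    back-Settles : Settles back

-- Every transition carries a certificate that it lowers the potential (see descent).
data Progress : Phase → Phase → ℕ → ℕ → Move → InSym → Set where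
  advance : ∀ {r r′ s} → {{NotRend s}} → {{T (r′ <ᵇ 4)}} → Progress scan scan r r′ mR s
  settle  : ∀ {p r r′ s} → {{Settles p}} → {{T (r′ <ᵇ r)}} → Progress p p r r′ mS s
  enter   : ∀ {r r′} → Progress scan copy r r′ mR (ins sV)
  copying : ∀ {r r′ s} → {{IsBit s}} → Progress copy copy r r′ mR (ins s)
  turn    : ∀ {r r′ s} → {{NotLend s}} → {{T (r′ <ᵇ 4)}} → Progress copy back r r′ mL s
  retreat : ∀ {r r′ s} → {{IsBit s}} → {{T (r′ <ᵇ 4)}} → Progress back back r r′ mL (ins s)
  leave   : ∀ {r r′ s} → {{NotRend s}} → {{T (r′ <ᵇ 4)}} → Progress back scan r r′ mR s

data Transition (q : St) (s : InSym) : Set where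
  go : ∀ {m} (q′ : St) → Maybe Sym → Progress (phase q) (phase q′) (rank q) (rank q′) m s → Transition q s

action : ∀ {q s} → Transition q s → St × Move × Maybe Sym
action (go {m} q′ e _) = q′ , m , e

δ′ : (q : St) (s : InSym) → Maybe (Transition q s)
δ′ copyVar     lend     = just (go copyVar     nothing   advance)
δ′ copyVar     (ins s0) = just (go copyVar     (just s0) advance)
δ′ copyVar     (ins s1) = just (go copyVar     (just s1) advance)
δ′ copyVar     (ins sC) = just (go readCode    (just sC) advance)
δ′ readCode    (ins s0) = just (go readCode0   nothing   advance)
δ′ readCode    (ins s1) = just (go readCode1   nothing   advance)
δ′ readCode    (ins sV) = just (go emitImplies (just sV) settle)
δ′ readCode0   (ins s0) = just (go readCode00  nothing   advance)
δ′ readCode0   (ins s1) = just (go readCode01  nothing   advance)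
δ′ readCode0   (ins sV) = just (go emitPos     (just sV) settle)
δ′ readCode1   (ins s0) = just (go readCode10  nothing   advance)
δ′ readCode1   (ins s1) = just (go readCode11  nothing   advance)
δ′ readCode1   (ins sV) = just (go emitNeg     (just sV) settle)
δ′ readCode00  (ins sV) = just (go emitContra  (just sV) settle)
δ′ readCode10  (ins sV) = just (go emitTaut    (just sV) settle)
δ′ readCode01  (ins sV) = just (go emitNeg     (just sV) settle)
δ′ readCode11  (ins sV) = just (go emitPos     (just sV) settle)
δ′ copyFirst   (ins s0) = just (go copyFirst   (just s0) advance)
δ′ copyFirst   (ins s1) = just (go copyFirst   (just s1) advance)
δ′ copyFirst   (ins sV) = just (go emitPos     (just sV) settle)
δ′ emitPos     (ins sV) = just (go copyVar     (just s1) advance)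
δ′ emitNeg     (ins sV) = just (go copyVar     (just s0) advance)
δ′ emitImplies (ins sV) = just (go copyFirst   (just s0) advance)
δ′ emitTaut    (ins sV) = just (go copyTaut    (just s1) enter)
δ′ emitContra  (ins sV) = just (go copyContra  (just s1) enter)
δ′ copyTaut    (ins s0) = just (go copyTaut    (just s0) copying)
δ′ copyTaut    (ins s1) = just (go copyTaut    (just s1) copying)
δ′ copyTaut    (ins sC) = just (go backTaut    nothing   turn)
δ′ copyTaut    rend     = just (go backTaut    nothing   turn)
δ′ copyContra  (ins s0) = just (go copyContra  (just s0) copying)
δ′ copyContra  (ins s1) = just (go copyContra  (just s1) copying)
δ′ copyContra  (ins sC) = just (go backContra  nothing   turn)
δ′ copyContra  rend     = just (go backContra  nothing   turn)
δ′ backTaut    (ins s0) = just (go backTaut    nothing   retreat)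
δ′ backTaut    (ins s1) = just (go backTaut    nothing   retreat)
δ′ backTaut    (ins sV) = just (go secondNeg   (just sV) settle)
δ′ backContra  (ins s0) = just (go backContra  nothing   retreat)
δ′ backContra  (ins s1) = just (go backContra  nothing   retreat)
δ′ backContra  (ins sV) = just (go openClause  (just sC) settle)
δ′ openClause  (ins sV) = just (go secondNeg   (just sV) settle)
δ′ secondNeg   (ins sV) = just (go copyVar     (just s0) leave)
δ′ _           _        = nothing

δ : St → InSym → Maybe (St × Move × Maybe Sym)
δ q s = Maybe.map action (δ′ q s)

open WorkTapeFree (lookup states) index copyVar δ

-- Termination

width base : List Sym → ℕ
width x = 2 + length x
base x = 4 * width x + 4

onBit : InSym → Bool
onBit (ins s0) = true
onBit (ins s1) = true
onBit _        = false

-- While a variable is copied, rewound and copied again, the last non-bit cell at or before the head is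
-- its separator sV: this anchor never moves left.
lastSep : List Sym → ℕ → ℕ
lastSep x zero    = zero
lastSep x (suc i) = if onBit (readIn x (suc i)) then lastSep x i else suc i

anchor : Phase → List Sym → ℕ → ℕ
anchor scan x i = i
anchor copy x i = lastSep x (pred i)
anchor back x i = lastSep x i

level : Phase → ℕ
level scan = 2
level copy = 1
level back = 0

level<4 : ∀ p → level p < 4
level<4 scan = s≤s (s≤s (s≤s z≤n))
level<4 copy = s≤s (s≤s z≤n)
level<4 back = s≤s z≤n

local : Phase → List Sym → ℕ → ℕ → ℕ
local scan x r i = r
local copy x r i = width x ∸ i
local back x r i = 4 * i + r

digit : List Sym → Phase → ℕ → ℕ
digit x p i = (width x ∸ anchor p x i) * 4 + level p

-- A mixed-radix numeral: the digit level has radix 4 and local stays below base x.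
height : List Sym → Phase → ℕ → ℕ → ℕ
height x p r i = digit x p i * base x + local p x r i

potential : List Sym → Conf → ℕ
potential x ⟨ q , i , _ ⟩ = height x (phase q) (rank q) i

mixed-< : ∀ {a a′ w w′} B → a′ < a → w′ < B → a′ * B + w′ < a * B + w
mixed-< {a} {a′} {w} {w′} B a′<a w′<B = begin-strict
  a′ * B + w′ <⟨ +-monoʳ-< (a′ * B) w′<B ⟩
  a′ * B + B  ≡⟨ +-comm (a′ * B) B ⟩
  suc a′ * B  ≤⟨ *-monoˡ-≤ B a′<a ⟩
  a * B       ≤⟨ m≤m+n (a * B) w ⟩
  a * B + w   ∎
  where open ≤-Reasoning

readIn-ins : ∀ x j {s} → readIn x (suc j) ≡ ins s → j < length x
readIn-ins (_ ∷ _)  zero    _  = s≤s z≤n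
readIn-ins (_ ∷ xs) (suc j) eq = s≤s (readIn-ins xs j eq)

readIn-lend : ∀ x j → ¬ readIn x (suc j) ≡ lend
readIn-lend (_ ∷ _)  zero    ()
readIn-lend (_ ∷ xs) (suc j) eq = readIn-lend xs j eq

readIn-inside : ∀ x i {s} → {{NotRend s}} → readIn x i ≡ s → i ≤ length x
readIn-inside x zero                        _  = z≤n
readIn-inside x (suc j) {{lend-NotRend}} eq = ⊥-elim (readIn-lend x j eq)
readIn-inside x (suc j) {{ins-NotRend}}  eq = readIn-ins x j eq

lastSep≤ : ∀ x i → lastSep x i ≤ i
lastSep≤ x zero = z≤n
lastSep≤ x (suc i) with onBit (readIn x (suc i))
... | true  = m≤n⇒m≤1+n (lastSep≤ x i)
... | false = ≤-refl

lastSep-bit : ∀ x j {s} → readIn x (suc j) ≡ ins s → IsBit s → lastSep x (suc j) ≡ lastSep x j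
lastSep-bit x j eq bit0 rewrite eq = refl
lastSep-bit x j eq bit1 rewrite eq = refl

lastSep-sV : ∀ x j → readIn x (suc j) ≡ ins sV → lastSep x (suc j) ≡ suc j
lastSep-sV x j eq rewrite eq = refl

module _ (x : List Sym) where

  private
    L = length x
    W = width x
    B = base x

  shrinks : ∀ {i} → i ≤ L → W ∸ suc i < W ∸ i
  shrinks i≤L = ∸-monoʳ-< (n<1+n _) (m≤n⇒m≤1+n (s≤s i≤L))

  scan-local< : ∀ {r} → r < 4 → r < B
  scan-local< r<4 = ≤-trans r<4 (m≤n+m 4 (4 * W))

  copy-local< : ∀ i → W ∸ i < B
  copy-local< i = ≤-<-trans (m∸n≤m W i) (≤-<-trans (m≤n*m W 4) (m<m+n (4 * W) (s≤s z≤n)))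

  back-local< : ∀ {i r} → i ≤ suc L → r < 4 → 4 * i + r < B
  back-local< {i} {r} i≤ r<4 = begin-strict
    4 * i + r <⟨ +-monoʳ-< (4 * i) r<4 ⟩
    4 * i + 4 ≤⟨ +-monoˡ-≤ 4 (*-monoʳ-≤ 4 (m≤n⇒m≤1+n i≤)) ⟩
    4 * W + 4 ∎
    where open ≤-Reasoning

  descent : ∀ {p p′ r r′ m s} i → Progress p p′ r r′ m s → readIn x i ≡ s → i ≤ suc L →
    height x p′ r′ (moveIn L m i) < height x p r i
  descent i (advance {r′ = r′} {{_}} {{r′<4}}) eq _ rewrite m≤n⇒m⊓n≡m (readIn-inside x i eq) =
    mixed-< B (mixed-< 4 (shrinks (readIn-inside x i eq)) (level<4 scan)) (scan-local< (<ᵇ⇒< r′ 4 r′<4))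
  descent i (settle {r = r} {r′} {{scan-Settles}} {{r′<r}}) _ _ =
    +-monoʳ-< (digit x scan i * B) (<ᵇ⇒< r′ r r′<r)
  descent i (settle {r = r} {r′} {{back-Settles}} {{r′<r}}) _ _ =
    +-monoʳ-< (digit x back i * B) (+-monoʳ-< (4 * i) (<ᵇ⇒< r′ r r′<r))
  descent (suc j) enter eq _ rewrite m≤n⇒m⊓n≡m (readIn-ins x j eq) | lastSep-sV x j eq =
    mixed-< B (+-monoʳ-< ((W ∸ suc j) * 4) ≤-refl) (copy-local< (suc (suc j)))
  descent (suc j) (copying {{bit}}) eq _ rewrite m≤n⇒m⊓n≡m (readIn-ins x j eq) | lastSep-bit x j eq bit =
    +-monoʳ-< (digit x copy (suc j) * B) (shrinks (readIn-ins x j eq))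
  descent zero    (turn {{()}}) refl _
  descent (suc j) (turn {r′ = r′} {{_}} {{r′<4}}) _ (s≤s j≤L) =
    mixed-< B (+-monoʳ-< ((W ∸ lastSep x j) * 4) ≤-refl) (back-local< (m≤n⇒m≤1+n j≤L) (<ᵇ⇒< r′ 4 r′<4))
  descent (suc j) (retreat {r = r} {r′} {{bit}} {{r′<4}}) eq _ rewrite lastSep-bit x j eq bit =
    +-monoʳ-< (digit x back j * B) (begin-strict
      4 * j + r′    <⟨ +-monoʳ-< (4 * j) (<ᵇ⇒< r′ 4 r′<4) ⟩
      4 * j + 4     ≡⟨ +-comm (4 * j) 4 ⟩
      4 + 4 * j     ≡⟨ sym (*-suc 4 j) ⟩
      4 * suc j     ≤⟨ m≤m+n (4 * suc j) r ⟩
      4 * suc j + r ∎)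
    where open ≤-Reasoning
  descent i (leave {r′ = r′} {{_}} {{r′<4}}) eq _ rewrite m≤n⇒m⊓n≡m (readIn-inside x i eq) =
    mixed-< B (mixed-< 4 (∸-monoʳ-< (s≤s (lastSep≤ x i)) (m≤n⇒m≤1+n (s≤s (readIn-inside x i eq))))
                         (level<4 scan))
              (scan-local< (<ᵇ⇒< r′ 4 r′<4))

potential-descends : ∀ x {a b} → Conf.pos a ≤ suc (length x) → next x a ≡ just b →
  potential x b < potential x a
potential-descends x {⟨ q , i , _ ⟩} i≤ move with δ′ q (readIn x i) | move
... | just (go _ _ progress) | refl = descent x i progress refl i≤

open Ranked potential potential-descends

quadratic≤power : ∀ {a b k} L → a + b ≤ k → 2 ≤ k → a * (L * L) + b * L ≤ k * L ^ k
quadratic≤power {a} {b} zero _ _ rewrite *-zeroʳ a | *-zeroʳ b = z≤n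
quadratic≤power {a} {b} {k} L@(suc _) a+b≤k 2≤k = begin
  a * (L * L) + b * L       ≤⟨ +-monoʳ-≤ (a * (L * L)) (*-monoʳ-≤ b (m≤m*n L L)) ⟩
  a * (L * L) + b * (L * L) ≡⟨ sym (*-distribʳ-+ (L * L) a b) ⟩
  (a + b) * (L * L)         ≤⟨ *-mono-≤ a+b≤k L*L≤L^k ⟩
  k * L ^ k                 ∎
  where
  open ≤-Reasoning
  L*L≤L^k : L * L ≤ L ^ k
  L*L≤L^k = subst (_≤ L ^ k) (cong (L *_) (*-identityʳ L)) (^-monoʳ-≤ L 2≤k)

initial-height : ∀ L → ((2 + L) * 4 + 2) * (4 * (2 + L) + 4) + 1 ≡ 16 * (L * L) + 88 * L + 121
initial-height = solve-∀

potential-initial≤ : ∀ x → potential x initial ≤ 121 * length x ^ 121 + 121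
potential-initial≤ x = subst (_≤ 121 * length x ^ 121 + 121) (sym (initial-height (length x)))
  (+-monoˡ-≤ 121 (quadratic≤power {16} {88} {121} (length x) (m≤m+n 104 17) (m≤m+n 2 119)))

bitsᵇ-bits : ∀ b → All IsBit (bitsᵇ b)
bitsᵇ-bits zero     = []
bitsᵇ-bits 2[1+ b ] = bit1 ∷ bitsᵇ-bits b
bitsᵇ-bits 1+[2 b ] = bit0 ∷ bitsᵇ-bits b

bin-bits : ∀ n → All IsBit (bin n)
bin-bits n = bitsᵇ-bits _

varBits : ∀ {n} → Fin n → List Sym
varBits v = bin (toℕ v)

var-bits : ∀ {n} (v : Fin n) → All IsBit (varBits v)
var-bits v = bin-bits (toℕ v)

reads-close : ∀ {P q q′ w u} → Reads P q w q′ u → Reads P q (w ++ []) q′ (u ++ [])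
reads-close = reads-cast (sym (++-identityʳ _)) (sym (++-identityʳ _))

reads-literal : ∀ {q e q′ p bs} →
  δ q (ins sV) ≡ just (e , mS , just sV) → δ e (ins sV) ≡ just (q′ , mR , just p) → Copying q′ →
  All IsBit bs → Reads U q (sV ∷ bs) q′ (sV ∷ p ∷ bs)
reads-literal stay emit copies bits = reads-stay stay (reads-right emit ⨾ reads-bits copies bits)

-- The trailing ++ [] that concatMap leaves after the last variable and the last clause is absorbed by
-- reads-close, or by reads-cast where it sits inside.
constraint-reads : ∀ {n} (c : Constraint n) →
  Reads AtBoundary copyVar (encConstraint c) copyVar (concatMap encClause (clauses c))
constraint-reads (implies , v ∷ w ∷ []) =
  reads-cast refl (cong (sC ∷_) (sym (++-assoc (sV ∷ s0 ∷ varBits v) (sV ∷ s1 ∷ varBits w) [])))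
    (reads-weaken (reads-right refl
      ⨾ reads-literal refl refl (copier refl refl) (var-bits v)
      ⨾ reads-close (reads-literal refl refl (copier refl refl) (var-bits w))))
constraint-reads (u01 , v ∷ []) =
  reads-weaken (reads-close (reads-right refl ⨾ reads-right refl
    ⨾ reads-literal refl refl (copier refl refl) (var-bits v)))
constraint-reads (u10 , v ∷ []) =
  reads-weaken (reads-close (reads-right refl ⨾ reads-right refl
    ⨾ reads-literal refl refl (copier refl refl) (var-bits v)))
constraint-reads (u00 , v ∷ []) =
  reads-cast refl (cong (λ t → sC ∷ sV ∷ s1 ∷ t) (++-assoc (varBits v) (sC ∷ sV ∷ s0 ∷ varBits v) []))
    (reads-close (reads-right refl ⨾ reads-right refl ⨾ reads-right refl
      ⨾ reads-stay refl (revisit refl (copier refl refl) refl refl (rewinder refl refl) (var-bits v)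
          (reads-stay refl (reads-literal refl refl (copier refl refl) (var-bits v))))))
constraint-reads (u11 , v ∷ []) =
  reads-close (reads-right refl ⨾ reads-right refl ⨾ reads-right refl
    ⨾ reads-stay refl (revisit refl (copier refl refl) refl refl (rewinder refl refl) (var-bits v)
        (reads-literal refl refl (copier refl refl) (var-bits v))))
constraint-reads (delta0 , v ∷ []) =
  reads-weaken (reads-close (reads-right refl ⨾ reads-right refl ⨾ reads-right refl
    ⨾ reads-literal refl refl (copier refl refl) (var-bits v)))
constraint-reads (delta1 , v ∷ []) =
  reads-weaken (reads-close (reads-right refl ⨾ reads-right refl ⨾ reads-right refl
    ⨾ reads-literal refl refl (copier refl refl) (var-bits v)))

at-boundary : ∀ {n} (I : ACSPInst n) {r} → r ≡ [] → AtBoundary (concatMap encConstraint I ++ r)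
at-boundary []      refl = inj₁ refl
at-boundary (c ∷ I) refl = inj₂ (_ , refl)

constraints-reads : ∀ {n} (I : ACSPInst n) →
  Reads (_≡ []) copyVar (concatMap encConstraint I) copyVar (concatMap encClause (translate I))
constraints-reads []      = reads-[]
constraints-reads (c ∷ I) =
  reads-cast refl (sym (concatMap-++ encClause (clauses c) (translate I)))
    (reads-then (constraint-reads c) (at-boundary I) (constraints-reads I))

readIn-end : ∀ x → readIn x (suc (length x)) ≡ rend
readIn-end []      = refl
readIn-end (_ ∷ x) = readIn-end x

halts-at-end : ∀ x o → next x ⟨ copyVar , suc (length x) , o ⟩ ≡ nothing
halts-at-end x o rewrite readIn-end x = refl

transduce-correct : ∀ {n} (I : ACSPInst n) → transduce (encACSP I) ≡ enc2CNF (translate I)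
transduce-correct {n} I = transduce-reaches (refl ◅ reads-instance) (halts-at-end x _)
  where
  x = encACSP I
  reads-instance = (reads-bits (copier refl refl) (bin-bits n) ⨾ constraints-reads I)
                     x [] [] [] refl (sym (++-identityʳ x))

lemma4p6 : Σ (List Sym → List Sym) λ h → LogspaceComputable h
    × ((n : ℕ) (I : ACSPInst n) → AcyclicACSP I →
    Σ ℕ λ m → Σ (TwoCNF m) λ φ → Acyclic2CNF φ
    × h (encACSP I) ≡ enc2CNF φ
    × countACSP I ≡ count2SAT φ)
lemma4p6 = transduce , transduce-logspace 121 potential-initial≤ ,
  λ n I acyclic → n , translate I , translate-acyclic I acyclic , transduce-correct I , translate-count I
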